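{- Let $n\ge1$. Among non-constant symmetric Boolean functions $f:\{0,1\}^n\to\{0,1\}$, the only ones with $\mathsf{InstC}(f)=1$ are the parity function $\mathsf{XOR}_n$ and its negation $1-\mathsf{XOR}_n$.
   Context: A function $f:\{0,1\}^n\to\{0,1\}$ is symmetric if $f(x)$ depends only on the Hamming weight $|x|$. $\mathsf{XOR}_n(x)=1$ iff $|x|$ is odd. A deterministic decision tree is a rooted binary tree whose internal nodes are labeled by variables, edges by $0/1$, leaves by output values in $\{0,1\}$; it evaluates an input by following the path determined by the queried variable values. It computes $f$ if it outputs $f(x)$ on every $x$; $\mathcal{T}(x)$ is the number of queries it makes on $x$. A certificate for $x$ w.r.t. $f$ is a set $S\subseteq[n]$ with $f(y)=f(x)$ for all $y$ agreeing with $x$ on $S$; $\mathsf{C}(f,x)$ is the minimum size of such a set. The instance complexity is $\mathsf{InstC}(f)=\min_{\mathcal{T}}\max_{x}\frac{\mathcal{T}(x)}{\mathsf{C}(f,x)}$ over decision trees $\mathcal{T}$ computing $f$. -}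

module Defs where

open import Data.Bool using (Bool; true; false; not)
open import Data.Nat using (ℕ; zero; suc; _+_; _*_; _≤_; _%_; _≡ᵇ_)
open import Data.Fin using (Fin)
open import Data.Fin.Subset using (Subset; _∈_; ∣_∣)
open import Data.Product using (Σ; ∃; _×_)
open import Relation.Binary.PropositionalEquality using (_≡_; _≢_)

-- Inputs x ∈ {0,1}^n, with false = 0 and true = 1.
Input : ℕ → Set
Input n = Fin n → Bool

BoolFun : ℕ → Set
BoolFun n = Input n → Bool

weight : ∀ {n} → Input n → ℕ
weight {zero}  x = 0
weight {suc n} x = (if' x Fin.zero) + weight {n} (λ i → x (Fin.suc i))
  where
  if' : ∀ {m} → (Fin (suc m) → Bool) → Fin (suc m) → ℕ
  if' y i with y i
  ... | true  = 1
  ... | false = 0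

Symmetric : ∀ {n} → BoolFun n → Set
Symmetric {n} f = ∀ (x y : Input n) → weight x ≡ weight y → f x ≡ f y

NonConstant : ∀ {n} → BoolFun n → Set
NonConstant {n} f = Σ (Input n) λ x → Σ (Input n) λ y → f x ≢ f y

XOR : ∀ {n} → BoolFun n
XOR x = weight x % 2 ≡ᵇ 1

data DTree (n : ℕ) : Set where
  leaf : Bool → DTree n
  node : Fin n → DTree n → DTree n → DTree n

eval : ∀ {n} → DTree n → Input n → Bool
eval (leaf b) x = b
eval (node i t₀ t₁) x with x i
... | false = eval t₀ x
... | true  = eval t₁ x

queries : ∀ {n} → DTree n → Input n → ℕ
queries (leaf b) x = 0
queries (node i t₀ t₁) x with x i
... | false = suc (queries t₀ x)
... | true  = suc (queries t₁ x)

Computes : ∀ {n} → DTree n → BoolFun n → Set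
Computes {n} T f = ∀ (x : Input n) → eval T x ≡ f x

IsCertificate : ∀ {n} → BoolFun n → Input n → Subset n → Set
IsCertificate {n} f x S = ∀ (y : Input n) → (∀ i → i ∈ S → y i ≡ x i) → f y ≡ f x

CertComplexity : ∀ {n} → BoolFun n → Input n → ℕ → Set
CertComplexity {n} f x c =
  (Σ (Subset n) λ S → IsCertificate f x S × ∣ S ∣ ≡ c)
  × (∀ (S : Subset n) → IsCertificate f x S → c ≤ ∣ S ∣)

-- InstC(f) = p/q (q > 0), ratios compared by cross-multiplication
-- (meaningful when every C(f,x) > 0, i.e. f non-constant):
--   some tree T computing f has max_x T(x)/C(f,x) = p/q, and
--   every tree T' computing f has max_x T'(x)/C(f,x) ≥ p/q.
InstCEq : ∀ {n} → BoolFun n → ℕ → ℕ → Set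
InstCEq {n} f p q =
  (Σ (DTree n) λ T → Computes T f
     × (∀ x c → CertComplexity f x c → queries T x * q ≤ p * c)
     × (Σ (Input n) λ x → ∀ c → CertComplexity f x c → queries T x * q ≡ p * c))
  × (∀ (T : DTree n) → Computes T f →
       Σ (Input n) λ x → ∀ c → CertComplexity f x c → p * c ≤ queries T x * q)

{-# OPTIONS --safe #-}
-- A symmetric f is determined by its profile G (its value at each Hamming weight),
-- and a set fixing a ones and b zeros of x certifies f at x exactly when G is
-- constant on the weights [a , n − b]. A tree computing f makes at least C(f,x)
-- queries on x (the queried set is a certificate), so InstC(f) = 1 means some tree
-- meets this bound on every input. For ±XOR every certificate is everything, and
-- the tree querying all variables is optimal. Conversely, follow an optimal tree
-- from the root: at a node reached by fixing a ones and b zeros, the reachable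
-- weights are [a , n − b]. At a leaf this interval must be a maximal block of G
-- (a wider constant interval gives a certificate shorter than the path), and at a
-- query of a fresh variable the children see [a + 1 , n − b] and [a , n − b − 1],
-- which is only consistent if G changes at every step of [a , n − b]. At the root
-- the interval is [0 , n]: G is constant, which is excluded, or alternating, so
-- f is XOR or its negation.
module Submission where

open import Defs
open import Data.Bool using (Bool; true; false; not; _xor_; if_then_else_)
open import Data.Bool.Properties using (¬-not; not-¬; not-involutive; not-distribʳ-xor; xor-identityʳ)
  renaming (_≟_ to _≟ᵇ_)
open import Data.Nat using (ℕ; zero; suc; _+_; _*_; _≤_; _<_; z≤n; s≤s; z<s; _%_; _≡ᵇ_; _<ᵇ_; _≤?_)
open import Data.Nat.Properties
open import Algebra.Properties.CommutativeSemigroup +-commutativeSemigroup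
  using (xy∙z≈zy∙x; x∙yz≈y∙xz) renaming (interchange to +-interchange)
open import Data.Fin using (zero; suc; toℕ) renaming (_≟_ to _≟ᶠ_)
open import Data.Fin.Properties using (all?)
open import Data.Fin.Subset using (Subset; _∈_; _∉_; ∣_∣; ⊤; ⊥; inside; outside)
open import Data.Fin.Subset.Properties
  using (_∈?_; anySubset?; ∈⊤; ∣⊤∣≡n; ∣⊥∣≡0; ∣p∣≤n; p⊆q⇒∣p∣≤∣q∣)
open import Data.Vec using ([]; _∷_; here; there; lookup; tabulate; _[_]≔_)
open import Data.Vec.Properties using (lookup∘tabulate; []≔-updates; []≔-minimal)
open import Data.Vec.Functional using (tail; updateAt) renaming (_∷_ to _◂_)
open import Data.Vec.Functional.Properties using (updateAt-updates; updateAt-minimal)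
open import Data.Product using (Σ; ∃; _×_; _,_; proj₁; proj₂)
open import Data.Sum using (_⊎_; inj₁; inj₂)
open import Function.Bundles using (_⇔_; mk⇔)
open import Function using (const; _∘_)
open import Relation.Nullary using (Dec; yes; no; ¬?; contradiction)
open import Relation.Nullary.Decidable using (decidable-stable; _×-dec_; _→-dec_)
open import Relation.Binary.PropositionalEquality

-- Hamming weight and parity

δ : Bool → Bool → ℕ
δ true  true  = 1
δ false false = 1
δ true  false = 0
δ false true  = 0

δ-true+δ-false : ∀ a → δ a true + δ a false ≡ 1
δ-true+δ-false true  = refl
δ-true+δ-false false = refl

δ≤1 : ∀ a b → δ a b ≤ 1
δ≤1 true  true  = ≤-refl
δ≤1 false false = ≤-refl
δ≤1 true  false = z≤n
δ≤1 false true  = z≤n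

weight-tail : ∀ {n} (x : Input (suc n)) → weight x ≡ δ (x zero) true + weight (tail x)
weight-tail x with x zero
... | true  = refl
... | false = refl

weight-cong : ∀ {n} {x y : Input n} → (∀ i → x i ≡ y i) → weight x ≡ weight y
weight-cong {zero}  x≗y = refl
weight-cong {suc n} {x} {y} x≗y = begin
  weight x                           ≡⟨ weight-tail x ⟩
  δ (x zero) true + weight (tail x)  ≡⟨ cong₂ (λ a w → δ a true + w) (x≗y zero) (weight-cong (x≗y ∘ suc)) ⟩
  δ (y zero) true + weight (tail y)  ≡⟨ weight-tail y ⟨
  weight y                           ∎
  where open ≡-Reasoning

weight≤n : ∀ {n} (x : Input n) → weight x ≤ n
weight≤n {zero}  x = z≤n
weight≤n {suc n} x rewrite weight-tail x = +-mono-≤ (δ≤1 (x zero) true) (weight≤n (tail x))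

weight-updateAt : ∀ {n} (x : Input n) i g →
  weight (updateAt x i g) + δ (x i) true ≡ weight x + δ (g (x i)) true
weight-updateAt {suc n} x zero g
  rewrite weight-tail (updateAt x zero g) | weight-tail x =
  xy∙z≈zy∙x (δ (g (x zero)) true) (weight (tail x)) (δ (x zero) true)
weight-updateAt {suc n} x (suc i) g
  rewrite weight-tail (updateAt x (suc i) g) | weight-tail x
        | +-assoc (δ (x zero) true) (weight (updateAt (tail x) i g)) (δ (x (suc i)) true)
        | +-assoc (δ (x zero) true) (weight (tail x)) (δ (g (x (suc i))) true) =
  cong (δ (x zero) true +_) (weight-updateAt (tail x) i g)

canonical : ∀ {n} → ℕ → Input n
canonical w i = toℕ i <ᵇ w

weight-canonical : ∀ {n} w → w ≤ n → weight (canonical {n} w) ≡ w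
weight-canonical {zero}  zero    _         = refl
weight-canonical {suc n} zero    _         = weight-canonical {n} zero z≤n
weight-canonical {suc n} (suc w) (s≤s w≤n) = cong suc (weight-canonical w w≤n)

parity : ℕ → Bool
parity w = w % 2 ≡ᵇ 1

parity-suc : ∀ w → parity (suc w) ≡ not (parity w)
parity-suc zero          = refl
parity-suc (suc zero)    = refl
parity-suc (suc (suc w)) = parity-suc w

-- Symmetric functions and subcubes

Extensional : ∀ {n} → BoolFun n → Set
Extensional {n} f = ∀ {x y : Input n} → (∀ i → x i ≡ y i) → f x ≡ f y

symmetric⇒extensional : ∀ {n} {f : BoolFun n} → Symmetric f → Extensional f
symmetric⇒extensional sym-f x≗y = sym-f _ _ (weight-cong x≗y)

profile : ∀ {n} → BoolFun n → ℕ → Bool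
profile f w = f (canonical w)

symmetric⇒profile : ∀ {n} {f : BoolFun n} → Symmetric f → ∀ x → f x ≡ profile f (weight x)
symmetric⇒profile sym-f x = sym-f _ _ (sym (weight-canonical (weight x) (weight≤n x)))

AgreeOn : ∀ {n} → Subset n → Input n → Input n → Set
AgreeOn S y x = ∀ i → i ∈ S → y i ≡ x i

agreeOn-tail : ∀ {n} {s S} {y x : Input (suc n)} → AgreeOn (s ∷ S) y x → AgreeOn S (tail y) (tail x)
agreeOn-tail y≈x i i∈S = y≈x (suc i) (there i∈S)

count : ∀ {n} → Bool → Subset n → Input n → ℕ
count b []            x = 0
count b (outside ∷ S) x = count b S (tail x)
count b (inside  ∷ S) x = δ (x zero) b + count b S (tail x)

count-true+count-false : ∀ {n} (S : Subset n) x → count true S x + count false S x ≡ ∣ S ∣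
count-true+count-false []            x = refl
count-true+count-false (outside ∷ S) x = count-true+count-false S (tail x)
count-true+count-false (inside  ∷ S) x = begin
  (δ a true + count true S (tail x)) + (δ a false + count false S (tail x))
    ≡⟨ +-interchange (δ a true) _ (δ a false) _ ⟩
  (δ a true + δ a false) + (count true S (tail x) + count false S (tail x))
    ≡⟨ cong₂ _+_ (δ-true+δ-false a) (count-true+count-false S (tail x)) ⟩
  suc ∣ S ∣ ∎
  where
  open ≡-Reasoning
  a = x zero

count-true+count-false≤n : ∀ {n} (S : Subset n) x → count true S x + count false S x ≤ n
count-true+count-false≤n {n} S x = subst (_≤ n) (sym (count-true+count-false S x)) (∣p∣≤n S)

count-⊥ : ∀ {n} b (x : Input n) → count b ⊥ x ≡ 0
count-⊥ {zero}  b x = refl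
count-⊥ {suc n} b x = count-⊥ b (tail x)

count-true≤weight : ∀ {n} (S : Subset n) {x y} → AgreeOn S y x → count true S x ≤ weight y
count-true≤weight []            y≈x = z≤n
count-true≤weight (outside ∷ S) {x} {y} y≈x rewrite weight-tail y =
  ≤-trans (count-true≤weight S (agreeOn-tail y≈x)) (m≤n+m _ _)
count-true≤weight (inside ∷ S) {x} {y} y≈x rewrite weight-tail y | y≈x zero here =
  +-monoʳ-≤ (δ (x zero) true) (count-true≤weight S (agreeOn-tail y≈x))

weight+count-false≤n : ∀ {n} (S : Subset n) {x y} → AgreeOn S y x → weight y + count false S x ≤ n
weight+count-false≤n []            y≈x = z≤n
weight+count-false≤n (outside ∷ S) {x} {y} y≈x rewrite weight-tail y
  | +-assoc (δ (y zero) true) (weight (tail y)) (count false S (tail x)) =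
  +-mono-≤ (δ≤1 (y zero) true) (weight+count-false≤n S (agreeOn-tail y≈x))
weight+count-false≤n {suc n} (inside ∷ S) {x} {y} y≈x rewrite weight-tail y | y≈x zero here = begin
  (δ a true + weight (tail y)) + (δ a false + count false S (tail x))
    ≡⟨ +-interchange (δ a true) _ (δ a false) _ ⟩
  (δ a true + δ a false) + (weight (tail y) + count false S (tail x))
    ≡⟨ cong (_+ (weight (tail y) + count false S (tail x))) (δ-true+δ-false a) ⟩
  suc (weight (tail y) + count false S (tail x))
    ≤⟨ s≤s (weight+count-false≤n S (agreeOn-tail y≈x)) ⟩
  suc n ∎
  where
  open ≤-Reasoning
  a = x zero

agreeOn-◂ : ∀ {n s S} {c : Bool} {y : Input n} {x} →
  (zero ∈ s ∷ S → c ≡ x zero) → AgreeOn S y (tail x) → AgreeOn (s ∷ S) (c ◂ y) x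
agreeOn-◂ head≡ y≈x zero    z∈S       = head≡ z∈S
agreeOn-◂ head≡ y≈x (suc i) (there i∈S) = y≈x i i∈S

count-inside : ∀ {n} (S : Subset n) x {b c k} → x zero ≡ c → count b S (tail x) ≡ k →
  count b (inside ∷ S) x ≡ δ c b + k
count-inside S x {b} x₀≡c ≡k = cong₂ (λ c k → δ c b + k) x₀≡c ≡k

agreeing-input-of-weight : ∀ {n} (S : Subset n) x {w} → count true S x ≤ w → w + count false S x ≤ n →
  Σ (Input n) λ y → AgreeOn S y x × weight y ≡ w
agreeing-input-of-weight []           x {zero} _ _ = (λ ()) , (λ ()) , refl
agreeing-input-of-weight (inside ∷ S) x {w} lo hi with x zero in x₀≡
agreeing-input-of-weight (inside ∷ S) x {suc w} (s≤s lo) (s≤s hi) | true =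
  let y , y≈x , ∣y∣≡w = agreeing-input-of-weight S (tail x) lo hi
  in true ◂ y , agreeOn-◂ (λ _ → sym x₀≡) y≈x , cong suc ∣y∣≡w
agreeing-input-of-weight {suc n} (inside ∷ S) x {w} lo hi | false =
  let y , y≈x , ∣y∣≡w = agreeing-input-of-weight S (tail x) lo (≤-pred (subst (_≤ suc n) (+-suc w _) hi))
  in false ◂ y , agreeOn-◂ (λ _ → sym x₀≡) y≈x , ∣y∣≡w
agreeing-input-of-weight {suc n} (outside ∷ S) x {w} lo hi with suc (count true S (tail x)) ≤? w
... | yes ct<w with w | ct<w | hi
...   | suc w | s≤s ct≤w | s≤s hi′ =
  let y , y≈x , ∣y∣≡w = agreeing-input-of-weight S (tail x) ct≤w hi′
  in true ◂ y , agreeOn-◂ (λ ()) y≈x , cong suc ∣y∣≡w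
agreeing-input-of-weight {suc n} (outside ∷ S) x {w} lo hi | no ct≮w =
  let y , y≈x , ∣y∣≡w = agreeing-input-of-weight S (tail x) lo w+cf≤n
  in false ◂ y , agreeOn-◂ (λ ()) y≈x , ∣y∣≡w
  where
  w+cf≤n : w + count false S (tail x) ≤ n
  w+cf≤n = subst (λ ct → ct + count false S (tail x) ≤ n) (≤-antisym lo (≮⇒≥ ct≮w))
                 (count-true+count-false≤n S (tail x))

subset-with-counts : ∀ {n} (x : Input n) {a b} → a ≤ weight x → weight x + b ≤ n →
  Σ (Subset n) λ S → count true S x ≡ a × count false S x ≡ b
subset-with-counts {zero}  x {zero} {zero} _ _ = [] , refl , refl
subset-with-counts {suc n} x {a} {b} lo hi rewrite weight-tail x with x zero in x₀≡
subset-with-counts {suc n} x {suc a} {b} (s≤s lo) (s≤s hi) | true =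
  let S , ≡a , ≡b = subset-with-counts (tail x) lo hi
  in inside ∷ S , count-inside S x x₀≡ ≡a , count-inside S x x₀≡ ≡b
subset-with-counts {suc n} x {zero} {b} lo (s≤s hi) | true =
  let S , ≡a , ≡b = subset-with-counts (tail x) z≤n hi
  in outside ∷ S , ≡a , ≡b
subset-with-counts {suc n} x {a} {suc b} lo hi | false =
  let S , ≡a , ≡b = subset-with-counts (tail x) lo (≤-pred (subst (_≤ suc n) (+-suc _ b) hi))
  in inside ∷ S , count-inside S x x₀≡ ≡a , count-inside S x x₀≡ ≡b
subset-with-counts {suc n} x {a} {zero} lo hi | false =
  let S , ≡a , ≡b = subset-with-counts (tail x) lo (subst (_≤ n) (sym (+-identityʳ _)) (weight≤n (tail x)))
  in outside ∷ S , ≡a , ≡b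

∈-insert⁺ : ∀ {n} {S : Subset n} {i j} → j ∈ S → j ∈ S [ i ]≔ inside
∈-insert⁺ {S = S} {i} {j} j∈S with j ≟ᶠ i
... | yes refl = []≔-updates S i
... | no  j≢i  = []≔-minimal S j i j≢i j∈S

∣insert∣≤ : ∀ {n} (S : Subset n) i → ∣ S [ i ]≔ inside ∣ ≤ suc ∣ S ∣
∣insert∣≤ (inside  ∷ S) zero    = n≤1+n _
∣insert∣≤ (outside ∷ S) zero    = ≤-refl
∣insert∣≤ (inside  ∷ S) (suc i) = s≤s (∣insert∣≤ S i)
∣insert∣≤ (outside ∷ S) (suc i) = ∣insert∣≤ S i

∣insert∣≡ : ∀ {n} (S : Subset n) i → i ∉ S → ∣ S [ i ]≔ inside ∣ ≡ suc ∣ S ∣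
∣insert∣≡ (inside  ∷ S) zero    i∉S = contradiction here i∉S
∣insert∣≡ (outside ∷ S) zero    _   = refl
∣insert∣≡ (inside  ∷ S) (suc i) i∉S = cong suc (∣insert∣≡ S i (i∉S ∘ there))
∣insert∣≡ (outside ∷ S) (suc i) i∉S = ∣insert∣≡ S i (i∉S ∘ there)

count-insert : ∀ {n} (S : Subset n) x i b c → i ∉ S →
  count c (S [ i ]≔ inside) (updateAt x i (const b)) ≡ δ b c + count c S x
count-insert (inside  ∷ S) x zero    b c i∉S = contradiction here i∉S
count-insert (outside ∷ S) x zero    b c _   = refl
count-insert (outside ∷ S) x (suc i) b c i∉S = count-insert S (tail x) i b c (i∉S ∘ there)
count-insert (inside  ∷ S) x (suc i) b c i∉S =
  trans (cong (δ (x zero) c +_) (count-insert S (tail x) i b c (i∉S ∘ there)))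
        (x∙yz≈y∙xz (δ (x zero) c) (δ b c) _)

agreeOn-insert : ∀ {n} {S : Subset n} {i x y b} → i ∉ S →
  AgreeOn (S [ i ]≔ inside) y (updateAt x i (const b)) → AgreeOn S y x × y i ≡ b
agreeOn-insert {S = S} {i} {x} i∉S y≈x′ =
  (λ j j∈S → trans (y≈x′ j (∈-insert⁺ j∈S)) (updateAt-minimal j i x λ { refl → i∉S j∈S })) ,
  trans (y≈x′ i ([]≔-updates S i)) (updateAt-updates i x)

-- Certificates

⊤-certificate : ∀ {n} {f : BoolFun n} → Extensional f → ∀ x → IsCertificate f x ⊤
⊤-certificate ext x y y≈x = ext λ i → y≈x i ∈⊤

allInputs? : ∀ {n} {P : Input n → Set} → (∀ {y y′} → (∀ i → y i ≡ y′ i) → P y → P y′) →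
  (∀ y → Dec (P y)) → Dec (∀ y → P y)
allInputs? resp P? with anySubset? (λ v → ¬? (P? (lookup v)))
... | yes (v , ¬Pv) = no λ ∀P → ¬Pv (∀P (lookup v))
... | no  ∄¬P       = yes λ y →
  resp (lookup∘tabulate y) (decidable-stable (P? _) λ ¬P → ∄¬P (tabulate y , ¬P))

isCertificate? : ∀ {n} {f : BoolFun n} → Extensional f → ∀ x S → Dec (IsCertificate f x S)
isCertificate? {f = f} ext x S =
  allInputs? respects λ y → all? (λ i → (i ∈? S) →-dec (y i ≟ᵇ x i)) →-dec (f y ≟ᵇ f x)
  where
  respects : ∀ {y y′} → (∀ i → y i ≡ y′ i) →
    (AgreeOn S y x → f y ≡ f x) → AgreeOn S y′ x → f y′ ≡ f x
  respects y≗y′ cert y′≈x =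
    trans (ext (sym ∘ y≗y′)) (cert λ i i∈S → trans (y≗y′ i) (y′≈x i i∈S))

smallestSubset : ∀ {n p} {P : Subset n → Set p} → (∀ S → Dec (P S)) →
  ∀ k S → P S → ∣ S ∣ ≤ k →
  Σ (Subset n) λ S → P S × (∀ S′ → P S′ → ∣ S ∣ ≤ ∣ S′ ∣)
smallestSubset P? zero    S PS ∣S∣≤0 = S , PS , λ _ _ → ≤-trans ∣S∣≤0 z≤n
smallestSubset P? (suc k) S PS ∣S∣≤k with anySubset? (λ S′ → P? S′ ×-dec (∣ S′ ∣ ≤? k))
... | yes (S′ , PS′ , ∣S′∣≤k) = smallestSubset P? k S′ PS′ ∣S′∣≤k
... | no  ∄smaller            = S , PS , λ S′ PS′ →
  ≤-trans ∣S∣≤k (≰⇒> λ ∣S′∣≤k → ∄smaller (S′ , PS′ , ∣S′∣≤k))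

certComplexity-exists : ∀ {n} {f : BoolFun n} → Extensional f → ∀ x → ∃ (CertComplexity f x)
certComplexity-exists {n} ext x =
  let S , cert , minimal =
        smallestSubset (isCertificate? ext x) n ⊤ (⊤-certificate ext x) (≤-reflexive (∣⊤∣≡n n))
  in ∣ S ∣ , (S , cert , refl) , minimal

module _ {n} {f : BoolFun n} (sym-f : Symmetric f) where

  constantProfile⇒certificate : ∀ x S →
    (∀ w → count true S x ≤ w → w + count false S x ≤ n → profile f w ≡ f x) → IsCertificate f x S
  constantProfile⇒certificate x S constant y y≈x = trans (symmetric⇒profile sym-f y)
    (constant (weight y) (count-true≤weight S y≈x) (weight+count-false≤n S y≈x))

  certComplexity≤ : ∀ {x a b c} → a ≤ weight x → weight x + b ≤ n →
    (∀ w → a ≤ w → w + b ≤ n → profile f w ≡ f x) → CertComplexity f x c → c ≤ a + b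
  certComplexity≤ {x} a≤∣x∣ ∣x∣+b≤n constant (_ , minimal) =
    let S , ≡a , ≡b = subset-with-counts x a≤∣x∣ ∣x∣+b≤n
    in subst₂ _≤_ refl (trans (sym (count-true+count-false S x)) (cong₂ _+_ ≡a ≡b))
         (minimal S (constantProfile⇒certificate x S λ w a≤w w+b≤n →
           constant w (subst (_≤ w) ≡a a≤w) (subst (λ b → w + b ≤ n) ≡b w+b≤n)))

sensitive⇒certComplexity≡n : ∀ {n} {f : BoolFun n} {x c} →
  (∀ i → f (updateAt x i not) ≢ f x) → CertComplexity f x c → c ≡ n
sensitive⇒certComplexity≡n {n} {f} {x} sensitive ((S , cert , ∣S∣≡c) , _) =
  trans (sym ∣S∣≡c) (≤-antisym (∣p∣≤n S) n≤∣S∣)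
  where
  i∈S : ∀ i → i ∈ S
  i∈S i with i ∈? S
  ... | yes i∈S = i∈S
  ... | no  i∉S = contradiction
    (cert (updateAt x i not) λ j j∈S → updateAt-minimal j i x λ { refl → i∉S j∈S }) (sensitive i)
  n≤∣S∣ : n ≤ ∣ S ∣
  n≤∣S∣ = subst (_≤ ∣ S ∣) (∣⊤∣≡n n) (p⊆q⇒∣p∣≤∣q∣ {p = ⊤} λ {i} _ → i∈S i)

-- Decision trees

eval-node : ∀ {n} {i} {t₀ t₁ : DTree n} {x b} → x i ≡ b →
  eval (node i t₀ t₁) x ≡ eval (if b then t₁ else t₀) x
eval-node {i = i} {x = x} refl with x i
... | true  = refl
... | false = refl

queries-node : ∀ {n} {i} {t₀ t₁ : DTree n} {x b} → x i ≡ b →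
  queries (node i t₀ t₁) x ≡ suc (queries (if b then t₁ else t₀) x)
queries-node {i = i} {x = x} refl with x i
... | true  = refl
... | false = refl

shift : ∀ {n} → DTree n → DTree (suc n)
shift (leaf b)       = leaf b
shift (node i t₀ t₁) = node (suc i) (shift t₀) (shift t₁)

eval-shift : ∀ {n} (t : DTree n) x → eval (shift t) x ≡ eval t (tail x)
eval-shift (leaf b)       x = refl
eval-shift (node i t₀ t₁) x with x (suc i)
... | true  = eval-shift t₁ x
... | false = eval-shift t₀ x

queries-shift : ∀ {n} (t : DTree n) x → queries (shift t) x ≡ queries t (tail x)
queries-shift (leaf b)       x = refl
queries-shift (node i t₀ t₁) x with x (suc i)
... | true  = cong suc (queries-shift t₁ x)
... | false = cong suc (queries-shift t₀ x)

fullTree : ∀ {n} → BoolFun n → DTree n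
fullTree {zero}  f = leaf (f λ ())
fullTree {suc n} f = node zero (shift (fullTree (f ∘ (false ◂_)))) (shift (fullTree (f ∘ (true ◂_))))

fullTree-branch : ∀ {n} (f : BoolFun (suc n)) (x : Input (suc n)) →
  (if x zero then shift (fullTree (f ∘ (true ◂_))) else shift (fullTree (f ∘ (false ◂_))))
    ≡ shift (fullTree (f ∘ (x zero ◂_)))
fullTree-branch f x with x zero
... | true  = refl
... | false = refl

eval-fullTree : ∀ {n} {f : BoolFun n} → Extensional f → ∀ x → eval (fullTree f) x ≡ f x
eval-fullTree {zero}      ext x = ext λ ()
eval-fullTree {suc n} {f} ext x = begin
  eval (fullTree f) x               ≡⟨ eval-node {b = x zero} refl ⟩
  eval (if x zero then _ else _) x  ≡⟨ cong (λ t → eval t x) (fullTree-branch f x) ⟩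
  eval (shift subtree) x            ≡⟨ eval-shift subtree x ⟩
  eval subtree (tail x)             ≡⟨ eval-fullTree ext′ (tail x) ⟩
  f (x zero ◂ tail x)               ≡⟨ ext (λ { zero → refl ; (suc i) → refl }) ⟩
  f x                               ∎
  where
  open ≡-Reasoning
  subtree = fullTree (f ∘ (x zero ◂_))
  ext′ : Extensional (f ∘ (x zero ◂_))
  ext′ y≗y′ = ext λ { zero → refl ; (suc i) → y≗y′ i }

queries-fullTree : ∀ {n} (f : BoolFun n) x → queries (fullTree f) x ≡ n
queries-fullTree {zero}  f x = refl
queries-fullTree {suc n} f x = begin
  queries (fullTree f) x                     ≡⟨ queries-node {b = x zero} refl ⟩
  suc (queries (if x zero then _ else _) x)  ≡⟨ cong (λ t → suc (queries t x)) (fullTree-branch f x) ⟩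
  suc (queries (shift subtree) x)            ≡⟨ cong suc (queries-shift subtree x) ⟩
  suc (queries subtree (tail x))             ≡⟨ cong suc (queries-fullTree _ (tail x)) ⟩
  suc n                                      ∎
  where
  open ≡-Reasoning
  subtree = fullTree (f ∘ (x zero ◂_))

pathSet : ∀ {n} → DTree n → Input n → Subset n
pathSet (leaf _)       x = ⊥
pathSet (node i t₀ t₁) x with x i
... | true  = pathSet t₁ x [ i ]≔ inside
... | false = pathSet t₀ x [ i ]≔ inside

∣pathSet∣≤queries : ∀ {n} (t : DTree n) x → ∣ pathSet t x ∣ ≤ queries t x
∣pathSet∣≤queries {n} (leaf _) x = ≤-reflexive (∣⊥∣≡0 n)
∣pathSet∣≤queries (node i t₀ t₁) x with x i
... | true  = ≤-trans (∣insert∣≤ (pathSet t₁ x) i) (s≤s (∣pathSet∣≤queries t₁ x))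
... | false = ≤-trans (∣insert∣≤ (pathSet t₀ x) i) (s≤s (∣pathSet∣≤queries t₀ x))

pathSet-certificate : ∀ {n} (t : DTree n) x y → AgreeOn (pathSet t x) y x → eval t y ≡ eval t x
pathSet-certificate (leaf _)       x y _ = refl
pathSet-certificate (node i t₀ t₁) x y y≈x with x i in xᵢ≡
... | true  rewrite trans (y≈x i ([]≔-updates (pathSet t₁ x) i)) xᵢ≡ =
  pathSet-certificate t₁ x y λ j j∈P → y≈x j (∈-insert⁺ j∈P)
... | false rewrite trans (y≈x i ([]≔-updates (pathSet t₀ x) i)) xᵢ≡ =
  pathSet-certificate t₀ x y λ j j∈P → y≈x j (∈-insert⁺ j∈P)

certComplexity≤queries : ∀ {n} {f : BoolFun n} T → Computes T f → ∀ x {c} →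
  CertComplexity f x c → c ≤ queries T x
certComplexity≤queries T T≡f x (_ , minimal) =
  ≤-trans (minimal (pathSet T x) certificate) (∣pathSet∣≤queries T x)
  where
  certificate : IsCertificate _ x (pathSet T x)
  certificate y y≈x = trans (sym (T≡f y)) (trans (pathSet-certificate T x y y≈x) (T≡f x))

instC≡1-intro : ∀ {n} {f : BoolFun n} T → Computes T f →
  (∀ x c → CertComplexity f x c → queries T x ≡ c) → InstCEq f 1 1
instC≡1-intro T T≡f exact =
  (T , T≡f , (λ x c C≡c → ≤-reflexive (ratio (exact x c C≡c))) ,
             (x₀ , λ c C≡c → ratio (exact x₀ c C≡c))) ,
  λ T′ T′≡f → x₀ , λ c C≡c →
    subst₂ _≤_ (sym (*-identityˡ c)) (sym (*-identityʳ _)) (certComplexity≤queries T′ T′≡f x₀ C≡c)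
  where
  x₀ = λ _ → false
  ratio : ∀ {a b} → a ≡ b → a * 1 ≡ 1 * b
  ratio {a} {b} a≡b = trans (*-identityʳ a) (trans a≡b (sym (*-identityˡ b)))

instC≡1-elim : ∀ {n} {f : BoolFun n} → InstCEq f 1 1 →
  Σ (DTree n) λ T → Computes T f × (∀ x c → CertComplexity f x c → queries T x ≤ c)
instC≡1-elim ((T , T≡f , bound , _) , _) =
  T , T≡f , λ x c C≡c → subst₂ _≤_ (*-identityʳ _) (*-identityˡ c) (bound x c C≡c)

-- Profiles

-- The pair (a , b) stands for the interval of weights [a , n ∸ b]; counting the
-- fixed zeros b instead of the upper end avoids truncated subtraction.
module Profile (n : ℕ) (G : ℕ → Bool) where

  HasValueOn : Bool → ℕ → ℕ → Set
  HasValueOn v a b = ∀ w → a ≤ w → w + b ≤ n → G w ≡ v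

  AlternatesOn : ℕ → ℕ → Set
  AlternatesOn a b = ∀ w → a ≤ w → suc w + b ≤ n → G (suc w) ≢ G w

  LeftEnd : ℕ → Set
  LeftEnd a = ∀ w → suc w ≡ a → G w ≢ G a

  RightEnd : ℕ → Set
  RightEnd b = ∀ w → w + b ≡ n → w < n → G (suc w) ≢ G w

  Bordered : ℕ → ℕ → Set
  Bordered a b = LeftEnd a × RightEnd b

  Block : ℕ → ℕ → Set
  Block a b = Bordered a b × HasValueOn (G a) a b

  Alternation : ℕ → ℕ → Set
  Alternation a b = Bordered a b × AlternatesOn a b

  BlockOrAlternation : ℕ → ℕ → Set
  BlockOrAlternation a b = Block a b ⊎ Alternation a b

  bordered : ∀ {a b} → BlockOrAlternation a b → Bordered a b
  bordered (inj₁ (ends , _)) = ends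
  bordered (inj₂ (ends , _)) = ends

  extendˡ : ∀ {v a b} → HasValueOn v (suc a) b → G a ≡ v → HasValueOn v a b
  extendˡ constant Ga≡v w a≤w w+b≤n with m≤n⇒m<n∨m≡n a≤w
  ... | inj₁ a<w  = constant w a<w w+b≤n
  ... | inj₂ refl = Ga≡v

  extendʳ : ∀ {v a b} → HasValueOn v a (suc b) →
    ∀ w → w + suc b ≡ n → G (suc w) ≡ v → HasValueOn v a b
  extendʳ {v} {a} {b} constant w w+1+b≡n Gw+1≡v w′ a≤w′ w′+b≤n with w′ + suc b ≤? n
  ... | yes w′+1+b≤n = constant w′ a≤w′ w′+1+b≤n
  ... | no  w′+1+b≰n = subst (λ u → G u ≡ v) (sym w′≡w+1) Gw+1≡v
    where
    w′+b≡n : w′ + b ≡ n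
    w′+b≡n = ≤-antisym w′+b≤n (≤-pred (≰⇒> (w′+1+b≰n ∘ subst (_≤ n) (sym (+-suc w′ b)))))
    w′≡w+1 : w′ ≡ suc w
    w′≡w+1 = +-cancelʳ-≡ b w′ (suc w) (trans w′+b≡n (trans (sym w+1+b≡n) (+-suc w b)))

  -- The children's intervals overlap unless [a , n ∸ b] has only two points, and on
  -- the overlap a constant child would contradict the border of the other child.
  combine : ∀ {a b} → BlockOrAlternation (suc a) b → BlockOrAlternation a (suc b) → Alternation a b
  combine {a} {b} upper lower = (proj₁ (bordered lower) , proj₂ (bordered upper)) , alternates lower
    where
    alternates : BlockOrAlternation a (suc b) → AlternatesOn a b
    alternates lower w a≤w w+1+b≤n with suc w + suc b ≤? n
    ... | no w+2+b≰n = proj₂ (bordered lower) w w+1+b≡n (subst (w <_) w+1+b≡n (m<m+n w z<s))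
      where
      w+1+b≡n : w + suc b ≡ n
      w+1+b≡n = ≤-antisym (subst (_≤ n) (sym (+-suc w b)) w+1+b≤n) (≤-pred (≰⇒> w+2+b≰n))
    ... | yes w+2+b≤n with m≤n⇒m<n∨m≡n a≤w | lower
    ...   | inj₂ refl | _ = proj₁ (bordered upper) a refl ∘ sym
    ...   | inj₁ a<w  | inj₂ (_ , lowerAlternates) = lowerAlternates w a≤w w+2+b≤n
    ...   | inj₁ a<w  | inj₁ (_ , lowerConstant) = contradiction
      (lowerConstant (suc a) (n≤1+n a) (≤-trans (+-monoˡ-≤ (suc b) a<w) (≤-trans (n≤1+n _) w+2+b≤n)))
      (proj₁ (bordered upper) a refl ∘ sym)

  alternation⇒parity : AlternatesOn 0 0 → ∀ w → w ≤ n → G w ≡ G 0 xor parity w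
  alternation⇒parity alternates zero    _   = sym (xor-identityʳ (G 0))
  alternation⇒parity alternates (suc w) w<n = begin
    G (suc w)              ≡⟨ ¬-not (alternates w z≤n (subst (_≤ n) (sym (+-identityʳ (suc w))) w<n)) ⟩
    not (G w)              ≡⟨ cong not (alternation⇒parity alternates w (≤-trans (n≤1+n w) w<n)) ⟩
    not (G 0 xor parity w) ≡⟨ not-distribʳ-xor (G 0) (parity w) ⟩
    G 0 xor not (parity w) ≡⟨ cong (G 0 xor_) (parity-suc w) ⟨
    G 0 xor parity (suc w) ∎
    where open ≡-Reasoning

-- Instance-optimal trees for symmetric functions

m+n≡o∧m<o⇒n≡1+ : ∀ {m n o} → m + n ≡ o → m < o → ∃ λ n′ → n ≡ suc n′
m+n≡o∧m<o⇒n≡1+ {m} {zero}   m+0≡o m<o = contradiction (trans (sym (+-identityʳ m)) m+0≡o) (<⇒≢ m<o)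
m+n≡o∧m<o⇒n≡1+ {n = suc n′} _     _   = n′ , refl

module _ {n} {f : BoolFun n} (sym-f : Symmetric f) where
  open Profile n (profile f)

  -- t is what remains of a tree after the coordinates in S have been queried and
  -- answered as in x; the bound charges those ∣ S ∣ queries as well.
  OptimalOn : DTree n → Subset n → Input n → Set
  OptimalOn t S x = ∀ y → AgreeOn S y x →
    eval t y ≡ f y × (∀ c → CertComplexity f y c → ∣ S ∣ + queries t y ≤ c)

  descend : ∀ {i t₀ t₁ S x S′ x′} b → ∣ S′ ∣ ≤ suc ∣ S ∣ →
    (∀ y → AgreeOn S′ y x′ → AgreeOn S y x × y i ≡ b) →
    OptimalOn (node i t₀ t₁) S x → OptimalOn (if b then t₁ else t₀) S′ x′
  descend {S = S} b ∣S′∣≤1+∣S∣ restrict optimal y y≈x′ =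
    let y≈x , yᵢ≡b = restrict y y≈x′
        correct , tight = optimal y y≈x
    in trans (sym (eval-node yᵢ≡b)) correct ,
       λ c C≡c → ≤-trans (+-monoˡ-≤ _ ∣S′∣≤1+∣S∣)
         (subst (_≤ c) (trans (cong (∣ S ∣ +_) (queries-node yᵢ≡b)) (+-suc ∣ S ∣ _)) (tight c C≡c))

  leaf-value : ∀ {v S x} → OptimalOn (leaf v) S x → HasValueOn v (count true S x) (count false S x)
  leaf-value {v} {S} {x} optimal w lo hi =
    let y , y≈x , ∣y∣≡w = agreeing-input-of-weight S x lo hi
    in begin
      profile f w          ≡⟨ cong (profile f) ∣y∣≡w ⟨
      profile f (weight y) ≡⟨ symmetric⇒profile sym-f y ⟨
      f y                  ≡⟨ proj₁ (optimal y y≈x) ⟨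
      v                    ∎
    where open ≡-Reasoning

  leaf-maximal : ∀ {v S x a b} → OptimalOn (leaf v) S x →
    a ≤ count true S x → count true S x + b ≤ n → HasValueOn v a b →
    count true S x + count false S x ≤ a + b
  leaf-maximal {v} {S} {x} {a} {b} optimal a≤ct ct+b≤n wider =
    let y , y≈x , ∣y∣≡ct = agreeing-input-of-weight S x ≤-refl (count-true+count-false≤n S x)
        c , C≡c = certComplexity-exists (symmetric⇒extensional sym-f) y
        fy≡v , tight = optimal y y≈x
    in ≤-trans
         (subst (_≤ c) (trans (+-identityʳ ∣ S ∣) (sym (count-true+count-false S x))) (tight c C≡c))
         (certComplexity≤ sym-f (subst (a ≤_) (sym ∣y∣≡ct) a≤ct)
                                (subst (λ w → w + b ≤ n) (sym ∣y∣≡ct) ct+b≤n)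
                                (λ w lo hi → trans (wider w lo hi) fy≡v) C≡c)

  leaf⇒block : ∀ {v S x} → OptimalOn (leaf v) S x → Block (count true S x) (count false S x)
  leaf⇒block {v} {S} {x} optimal = (leftEnd , rightEnd) , λ w lo hi → trans (value w lo hi) (sym Gct≡v)
    where
    ct = count true S x
    cf = count false S x
    value = leaf-value optimal
    Gct≡v : profile f ct ≡ v
    Gct≡v = value ct ≤-refl (count-true+count-false≤n S x)
    leftEnd : LeftEnd ct
    leftEnd w w+1≡ct Gw≡Gct = <-irrefl refl (subst (_≤ w) (sym w+1≡ct) (+-cancelʳ-≤ cf ct w
      (leaf-maximal optimal (≤-trans (n≤1+n w) (≤-reflexive w+1≡ct)) (count-true+count-false≤n S x)
        (extendˡ (subst (λ a → HasValueOn v a cf) (sym w+1≡ct) value) (trans Gw≡Gct Gct≡v)))))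
    rightEnd : RightEnd cf
    rightEnd w w+cf≡n w<n Gw+1≡Gw with m+n≡o∧m<o⇒n≡1+ w+cf≡n w<n
    ... | b′ , cf≡1+b′ = <-irrefl refl (subst (_≤ b′) cf≡1+b′ (+-cancelˡ-≤ ct cf b′
      (leaf-maximal optimal ≤-refl (≤-trans (+-monoʳ-≤ ct (subst (b′ ≤_) (sym cf≡1+b′) (n≤1+n b′)))
                                              (count-true+count-false≤n S x))
        (extendʳ (subst (HasValueOn v ct) cf≡1+b′ value) w (subst (λ b → w + b ≡ n) cf≡1+b′ w+cf≡n)
          (trans Gw+1≡Gw (value w ct≤w (≤-reflexive w+cf≡n)))))))
      where
      ct≤w : ct ≤ w
      ct≤w = +-cancelʳ-≤ cf ct w (subst (ct + cf ≤_) (sym w+cf≡n) (count-true+count-false≤n S x))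

  optimal⇒blockOrAlternation : ∀ t S x → OptimalOn t S x →
    BlockOrAlternation (count true S x) (count false S x)
  optimal⇒blockOrAlternation (leaf v) S x optimal = inj₁ (leaf⇒block optimal)
  optimal⇒blockOrAlternation (node i t₀ t₁) S x optimal with i ∈? S
  ... | yes i∈S with x i in xᵢ≡
  ...   | true  = optimal⇒blockOrAlternation t₁ S x
    (descend true  (n≤1+n _) (λ y y≈x → y≈x , trans (y≈x i i∈S) xᵢ≡) optimal)
  ...   | false = optimal⇒blockOrAlternation t₀ S x
    (descend false (n≤1+n _) (λ y y≈x → y≈x , trans (y≈x i i∈S) xᵢ≡) optimal)
  optimal⇒blockOrAlternation (node i t₀ t₁) S x optimal | no i∉S = inj₂ (combine upper lower)
    where
    child : ∀ b → OptimalOn (if b then t₁ else t₀) (S [ i ]≔ inside) (updateAt x i (const b))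
    child b = descend b (≤-reflexive (∣insert∣≡ S i i∉S)) (λ _ → agreeOn-insert i∉S) optimal
    upper : BlockOrAlternation (suc (count true S x)) (count false S x)
    upper = subst₂ BlockOrAlternation (count-insert S x i true true i∉S) (count-insert S x i true false i∉S)
      (optimal⇒blockOrAlternation t₁ _ _ (child true))
    lower : BlockOrAlternation (count true S x) (suc (count false S x))
    lower = subst₂ BlockOrAlternation (count-insert S x i false true i∉S) (count-insert S x i false false i∉S)
      (optimal⇒blockOrAlternation t₀ _ _ (child false))

  instC≡1⇒parity : NonConstant f → InstCEq f 1 1 → ∃ λ s → ∀ x → f x ≡ s xor XOR x
  instC≡1⇒parity (x₁ , x₂ , fx₁≢fx₂) instC≡1 with instC≡1-elim instC≡1
  ... | T , T≡f , tight with subst₂ BlockOrAlternation (count-⊥ true x₀) (count-⊥ false x₀)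
                           (optimal⇒blockOrAlternation T ⊥ x₀ rootOptimal)
    where
    x₀ : Input n
    x₀ _ = false
    rootOptimal : OptimalOn T ⊥ x₀
    rootOptimal y _ = T≡f y , λ c C≡c →
      subst (_≤ c) (cong (_+ queries T y) (sym (∣⊥∣≡0 n))) (tight y c C≡c)
  ... | inj₁ (_ , constant) = contradiction (trans (onProfile x₁) (sym (onProfile x₂))) fx₁≢fx₂
    where
    onProfile : ∀ x → f x ≡ profile f 0
    onProfile x = trans (symmetric⇒profile sym-f x)
      (constant (weight x) z≤n (subst (_≤ n) (sym (+-identityʳ _)) (weight≤n x)))
  ... | inj₂ (_ , alternates) = profile f 0 , λ x →
    trans (symmetric⇒profile sym-f x) (alternation⇒parity alternates (weight x) (weight≤n x))

parity-flip : ∀ {n} (x : Input n) i → parity (weight (updateAt x i not)) ≡ not (parity (weight x))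
parity-flip x i = parity-step (x i) (weight-updateAt x i not)
  where
  parity-step : ∀ a {w′ w} → w′ + δ a true ≡ w + δ (not a) true → parity w′ ≡ not (parity w)
  parity-step true {w′} {w} w′+1≡w+0 = begin
    parity w′               ≡⟨ not-involutive _ ⟨
    not (not (parity w′))   ≡⟨ cong not (parity-suc w′) ⟨
    not (parity (suc w′))   ≡⟨ cong (not ∘ parity) (trans (+-comm 1 w′) w′+1≡w+0) ⟩
    not (parity (w + 0))    ≡⟨ cong (not ∘ parity) (+-identityʳ w) ⟩
    not (parity w)          ∎
    where open ≡-Reasoning
  parity-step false {w′} {w} w′+0≡w+1 = begin
    parity w′               ≡⟨ cong parity (+-identityʳ w′) ⟨
    parity (w′ + 0)         ≡⟨ cong parity (trans w′+0≡w+1 (+-comm w 1)) ⟩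
    parity (suc w)          ≡⟨ parity-suc w ⟩
    not (parity w)          ∎
    where open ≡-Reasoning

parity⇒instC≡1 : ∀ {n} {f : BoolFun n} → Symmetric f → ∀ s →
  (∀ x → f x ≡ s xor XOR x) → InstCEq f 1 1
parity⇒instC≡1 {f = f} sym-f s f≡s⊕XOR =
  instC≡1-intro (fullTree f) (eval-fullTree (symmetric⇒extensional sym-f)) λ x c C≡c →
    trans (queries-fullTree f x) (sym (sensitive⇒certComplexity≡n (sensitive x) C≡c))
  where
  sensitive : ∀ x i → f (updateAt x i not) ≢ f x
  sensitive x i f′≡f = not-¬ refl (begin
    f x                                               ≡⟨ f′≡f ⟨
    f (updateAt x i not)                              ≡⟨ f≡s⊕XOR _ ⟩
    s xor parity (weight (updateAt x i not))          ≡⟨ cong (s xor_) (parity-flip x i) ⟩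
    s xor not (parity (weight x))                     ≡⟨ not-distribʳ-xor s _ ⟨
    not (s xor parity (weight x))                     ≡⟨ cong not (f≡s⊕XOR x) ⟨
    not (f x)                                         ∎)
    where open ≡-Reasoning

corollary3p5 : (n : ℕ) → 1 ≤ n → (f : BoolFun n) → Symmetric f → NonConstant f →
    (InstCEq f 1 1 ⇔ ((∀ x → f x ≡ XOR x) ⊎ (∀ x → f x ≡ not (XOR x))))
corollary3p5 n _ f sym-f nonConstant = mk⇔
  (λ instC≡1 → let s , f≡s⊕XOR = instC≡1⇒parity sym-f nonConstant instC≡1 in byCase s f≡s⊕XOR)
  λ { (inj₁ f≡XOR)  → parity⇒instC≡1 sym-f false f≡XOR
    ; (inj₂ f≡¬XOR) → parity⇒instC≡1 sym-f true  f≡¬XOR }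
  where
  byCase : ∀ s → (∀ x → f x ≡ s xor XOR x) → (∀ x → f x ≡ XOR x) ⊎ (∀ x → f x ≡ not (XOR x))
  byCase false f≡XOR  = inj₁ f≡XOR
  byCase true  f≡¬XOR = inj₂ f≡¬XOR
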